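{- Let $H$ be an $r$-uniform hypergraph ($r\ge 2$) with $n\geq 3$ vertices, $m$ edges and degree sequence $d_{1}\geq d_{2}\geq \cdots\geq d_{n}$, and let $M=\sum_{i=1}^{n}d_{i}^{2}$. Then $$\frac{r^{2}m^{2}}{n} \leq M\leq r^{2}m^{2}-n(n-1)d_{n}^{2},$$ with equalities holding if and only if $H$ is regular.
   Context: A hypergraph $H=(V,E)$ is $r$-uniform if every edge is a set of exactly $r$ vertices; hypergraphs are simple (no repeated edges). The degree $d_i$ of vertex $v_i$ is the number of edges containing it, so $\sum_i d_i = rm$. $M$ is the first Zagreb index. -}

module Defs where

open import Data.Nat using (ℕ; zero; suc; _⊓_; _+_; _*_)
open import Data.Fin using (Fin; zero; suc)
open import Data.Fin.Subset using (Subset; _∈_; ∣_∣)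
open import Data.Fin.Subset.Properties using (_∈?_)
open import Data.List using (List; length; filter)
open import Data.List.Relation.Unary.All using (All)
open import Data.List.Relation.Unary.Unique.Propositional using (Unique)
open import Data.Vec using (Vec; tabulate; sum)
open import Relation.Binary.PropositionalEquality using (_≡_)

record Hypergraph (n r : ℕ) : Set where
  field
    edges   : List (Subset n)
    uniform : All (λ e → ∣ e ∣ ≡ r) edges
    simple  : Unique edges

open Hypergraph public

numEdges : ∀ {n r} → Hypergraph n r → ℕ
numEdges H = length (edges H)

degree : ∀ {n r} → Hypergraph n r → Fin n → ℕ
degree H v = length (filter (λ e → v ∈? e) (edges H))

Σᵥ : ∀ {n} → (Fin n → ℕ) → ℕ
Σᵥ f = sum (tabulate f)

zagreb₁ : ∀ {n r} → Hypergraph n r → ℕ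
zagreb₁ H = Σᵥ (λ v → degree H v * degree H v)

minOf : ∀ {n} → (Fin n → ℕ) → ℕ
minOf {zero} f = 0
minOf {suc zero} f = f zero
minOf {suc (suc n)} f = f zero ⊓ minOf (λ i → f (suc i))

-- minimum degree d_n (the last entry of the nonincreasing degree sequence)
minDegree : ∀ {n r} → Hypergraph n r → ℕ
minDegree H = minOf (degree H)

Regular : ∀ {n r} → Hypergraph n r → Set
Regular {n} H = ∀ (u v : Fin n) → degree H u ≡ degree H v

{-# OPTIONS --safe #-}
module Submission where

-- With D = Σ dᵢ = r m, expand D² = Σᵢ Σⱼ dᵢ dⱼ.  Since 2 dᵢ dⱼ ≤ dᵢ² + dⱼ² with equality iff dᵢ = dⱼ,
-- summing over all pairs gives D² ≤ n M, with equality iff H is regular.  Splitting off the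
-- diagonal, D² = M + Σ_{i ≠ j} dᵢ dⱼ ≥ M + n (n − 1) δ² for the minimum degree δ, with equality iff
-- every dᵢ dⱼ (i ≠ j) equals δ².  If δ > 0 this makes every degree equal to δ; if δ = 0 it gives
-- M = D², while M ≤ m D = r m² < r² m² = D² as soon as H has an edge and r ≥ 2.

open import Defs
open import Data.Nat using (ℕ; zero; suc; _+_; _*_; _∸_; _≤_; z≤n; s≤s; z<s; ∣_-_∣; NonZero; ≢-nonZero)
import Data.Nat as ℕ
open import Data.Nat.Properties hiding (_≟_)
open import Data.Nat.Tactic.RingSolver using (solve-∀)
open import Algebra.Properties.Semiring.Sum +-*-semiring
  using (sum; sum-syntax; sum⁺-syntax; sum-cong-≗; sum-remove; ∑-distrib-+; *-distribˡ-sum; *-distribʳ-sum)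
open import Data.Bool using (if_then_else_)
open import Data.Fin using (Fin; punchIn; punchOut; _≟_) renaming (zero to fzero; suc to fsuc)
open import Data.Fin.Properties using (punchIn-punchOut)
open import Data.Fin.Subset using (Subset; inside; outside; ∣_∣)
open import Data.Fin.Subset.Properties using (_∈?_)
open import Data.List using (List; []; _∷_; length; filter)
open import Data.List.Properties using (length-filter)
open import Data.List.Relation.Unary.All using (All; []; _∷_)
open import Data.Product using (_×_; _,_; proj₁; proj₂; ∃-syntax)
open import Data.Sum using (inj₁; inj₂; reduce)
open import Data.Vec using ([]; _∷_)
open import Data.Vec.Functional using (Vector)
open import Function using (_∘_)
open import Function.Bundles using (_⇔_; mk⇔; Equivalence)
open import Function.Construct.Composition using (_⇔-∘_)
open import Relation.Nullary using (yes; no; does; contradiction)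
open import Relation.Binary.PropositionalEquality
  using (_≡_; refl; sym; trans; cong; cong₂; subst; _≗_; module ≡-Reasoning)

sum-const : ∀ n x → ∑[ i < n ] x ≡ n * x
sum-const zero    x = refl
sum-const (suc n) x = cong (x +_) (sum-const n x)

sum-mono-≤ : ∀ {n} {f g : Vector ℕ n} → (∀ i → f i ≤ g i) → sum f ≤ sum g
sum-mono-≤ {zero}  f≤g = z≤n
sum-mono-≤ {suc n} f≤g = +-mono-≤ (f≤g fzero) (sum-mono-≤ (f≤g ∘ fsuc))

+-mono-≤-≡⇒≡ : ∀ {a b c d} → a ≤ c → b ≤ d → a + b ≡ c + d → a ≡ c × b ≡ d
+-mono-≤-≡⇒≡ {a} {b} {c} {d} a≤c b≤d eq = a≡c , +-cancelˡ-≡ a b d (trans eq (cong (_+ d) (sym a≡c)))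
  where
  a≡c : a ≡ c
  a≡c = ≤-antisym a≤c (≮⇒≥ λ a<c → <-irrefl eq (+-mono-<-≤ a<c b≤d))

sum-mono-≤-≡⇒≗ : ∀ {n} {f g : Vector ℕ n} → (∀ i → f i ≤ g i) → sum f ≡ sum g → f ≗ g
sum-mono-≤-≡⇒≗ {suc n} f≤g eq fzero    = proj₁ (+-mono-≤-≡⇒≡ (f≤g fzero) (sum-mono-≤ (f≤g ∘ fsuc)) eq)
sum-mono-≤-≡⇒≗ {suc n} f≤g eq (fsuc i) =
  sum-mono-≤-≡⇒≗ (f≤g ∘ fsuc) (proj₂ (+-mono-≤-≡⇒≡ (f≤g fzero) (sum-mono-≤ (f≤g ∘ fsuc)) eq)) i

sum*sum≡∑∑ : ∀ {m n} (f : Vector ℕ m) (g : Vector ℕ n) →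
             sum f * sum g ≡ ∑[ i < m ] ∑[ j < n ] (f i * g j)
sum*sum≡∑∑ f g = trans (*-distribʳ-sum (sum g) f) (sum-cong-≗ λ i → *-distribˡ-sum (f i) g)

m≤n⇒m*m+n*n≡2*[m*n]+∣m-n∣² : ∀ {m n} → m ≤ n → m * m + n * n ≡ 2 * (m * n) + ∣ m - n ∣ * ∣ m - n ∣
m≤n⇒m*m+n*n≡2*[m*n]+∣m-n∣² {m} m≤n with m≤n⇒∃[o]m+o≡n m≤n
... | k , refl rewrite ∣m-m+n∣≡n m k = square-identity m k
  where
  square-identity : ∀ m k → m * m + (m + k) * (m + k) ≡ 2 * (m * (m + k)) + k * k
  square-identity = solve-∀

m*m+n*n≡2*[m*n]+∣m-n∣² : ∀ m n → m * m + n * n ≡ 2 * (m * n) + ∣ m - n ∣ * ∣ m - n ∣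
m*m+n*n≡2*[m*n]+∣m-n∣² m n with ≤-total m n
... | inj₁ m≤n = m≤n⇒m*m+n*n≡2*[m*n]+∣m-n∣² m≤n
... | inj₂ n≤m = begin
  m * m + n * n                      ≡⟨ +-comm (m * m) (n * n) ⟩
  n * n + m * m                      ≡⟨ m≤n⇒m*m+n*n≡2*[m*n]+∣m-n∣² n≤m ⟩
  2 * (n * m) + ∣ n - m ∣ * ∣ n - m ∣  ≡⟨ cong₂ (λ a b → 2 * a + b * b) (*-comm n m) (∣-∣-comm n m) ⟩
  2 * (m * n) + ∣ m - n ∣ * ∣ m - n ∣  ∎
  where open ≡-Reasoning

2*[m*n]≤m*m+n*n : ∀ m n → 2 * (m * n) ≤ m * m + n * n
2*[m*n]≤m*m+n*n m n = subst (2 * (m * n) ≤_) (sym (m*m+n*n≡2*[m*n]+∣m-n∣² m n)) (m≤m+n _ _)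

2*[m*n]≡m*m+n*n⇒m≡n : ∀ m n → 2 * (m * n) ≡ m * m + n * n → m ≡ n
2*[m*n]≡m*m+n*n⇒m≡n m n eq = ∣m-n∣≡0⇒m≡n (reduce (m*n≡0⇒m≡0∨n≡0 _ ∣m-n∣²≡0))
  where
  ∣m-n∣²≡0 : ∣ m - n ∣ * ∣ m - n ∣ ≡ 0
  ∣m-n∣²≡0 = +-cancelˡ-≡ (2 * (m * n)) _ 0
    (trans (sym (m*m+n*n≡2*[m*n]+∣m-n∣² m n)) (trans (sym eq) (sym (+-identityʳ _))))

sumSq : ∀ {n} → Vector ℕ n → ℕ
sumSq {n} f = ∑[ i < n ] (f i * f i)

Constant : ∀ {n} → Vector ℕ n → Set
Constant {n} f = ∀ (i j : Fin n) → f i ≡ f j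

∑∑[2*fᵢ*fⱼ]≡2*sum*sum : ∀ {n} (f : Vector ℕ n) →
                        ∑[ i < n ] ∑[ j < n ] (2 * (f i * f j)) ≡ 2 * (sum f * sum f)
∑∑[2*fᵢ*fⱼ]≡2*sum*sum {n} f = begin
  ∑[ i < n ] ∑[ j < n ] (2 * (f i * f j))  ≡⟨ sum-cong-≗ (λ i → *-distribˡ-sum 2 (λ j → f i * f j)) ⟨
  ∑[ i < n ] (2 * ∑[ j < n ] (f i * f j))  ≡⟨ *-distribˡ-sum 2 (λ i → ∑[ j < n ] (f i * f j)) ⟨
  2 * ∑[ i < n ] ∑[ j < n ] (f i * f j)    ≡⟨ cong (2 *_) (sum*sum≡∑∑ f f) ⟨
  2 * (sum f * sum f)                      ∎
  where open ≡-Reasoning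

∑∑[fᵢ²+fⱼ²]≡2*[n*sumSq] : ∀ {n} (f : Vector ℕ n) →
                          ∑[ i < n ] ∑[ j < n ] (f i * f i + f j * f j) ≡ 2 * (n * sumSq f)
∑∑[fᵢ²+fⱼ²]≡2*[n*sumSq] {n} f = begin
  ∑[ i < n ] ∑[ j < n ] (f i * f i + f j * f j)
    ≡⟨ sum-cong-≗ (λ i → ∑-distrib-+ (λ _ → f i * f i) (λ j → f j * f j)) ⟩
  ∑[ i < n ] (∑[ j < n ] (f i * f i) + sumSq f)
    ≡⟨ ∑-distrib-+ (λ i → ∑[ j < n ] (f i * f i)) (λ _ → sumSq f) ⟩
  ∑[ i < n ] ∑[ j < n ] (f i * f i) + ∑[ i < n ] sumSq f
    ≡⟨ cong₂ _+_ (sum-cong-≗ (λ i → sum-const n (f i * f i))) (sum-const n (sumSq f)) ⟩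
  ∑[ i < n ] (n * (f i * f i)) + n * sumSq f
    ≡⟨ cong (_+ n * sumSq f) (*-distribˡ-sum n (λ i → f i * f i)) ⟨
  n * sumSq f + n * sumSq f
    ≡⟨ cong (n * sumSq f +_) (+-identityʳ _) ⟨
  2 * (n * sumSq f)
    ∎
  where open ≡-Reasoning

sum*sum≤n*sumSq : ∀ {n} (f : Vector ℕ n) → sum f * sum f ≤ n * sumSq f
sum*sum≤n*sumSq {n} f = *-cancelˡ-≤ 2 (begin
  2 * (sum f * sum f)                            ≡⟨ ∑∑[2*fᵢ*fⱼ]≡2*sum*sum f ⟨
  ∑[ i < n ] ∑[ j < n ] (2 * (f i * f j))        ≤⟨ sum-mono-≤ (λ i → sum-mono-≤ (λ j → 2*[m*n]≤m*m+n*n (f i) (f j))) ⟩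
  ∑[ i < n ] ∑[ j < n ] (f i * f i + f j * f j)  ≡⟨ ∑∑[fᵢ²+fⱼ²]≡2*[n*sumSq] f ⟩
  2 * (n * sumSq f)                              ∎)
  where open ≤-Reasoning

sum*sum≡n*sumSq⇔Constant : ∀ {n} (f : Vector ℕ n) → (sum f * sum f ≡ n * sumSq f) ⇔ Constant f
sum*sum≡n*sumSq⇔Constant {n} f = mk⇔ equality⇒constant constant⇒equality
  where
  termwise : ∀ i j → 2 * (f i * f j) ≤ f i * f i + f j * f j
  termwise i j = 2*[m*n]≤m*m+n*n (f i) (f j)

  equality⇒constant : sum f * sum f ≡ n * sumSq f → Constant f
  equality⇒constant eq i j = 2*[m*n]≡m*m+n*n⇒m≡n (f i) (f j)
    (sum-mono-≤-≡⇒≗ (termwise i) (sum-mono-≤-≡⇒≗ (λ i → sum-mono-≤ (termwise i)) doubled i) j)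
    where
    doubled : ∑[ i < n ] ∑[ j < n ] (2 * (f i * f j)) ≡ ∑[ i < n ] ∑[ j < n ] (f i * f i + f j * f j)
    doubled = trans (∑∑[2*fᵢ*fⱼ]≡2*sum*sum f) (trans (cong (2 *_) eq) (sym (∑∑[fᵢ²+fⱼ²]≡2*[n*sumSq] f)))

  constant⇒equality : Constant f → sum f * sum f ≡ n * sumSq f
  constant⇒equality c = *-cancelˡ-≡ _ _ 2 (begin
    2 * (sum f * sum f)                            ≡⟨ ∑∑[2*fᵢ*fⱼ]≡2*sum*sum f ⟨
    ∑[ i < n ] ∑[ j < n ] (2 * (f i * f j))        ≡⟨ sum-cong-≗ (λ i → sum-cong-≗ (termwise-≡ i)) ⟩
    ∑[ i < n ] ∑[ j < n ] (f i * f i + f j * f j)  ≡⟨ ∑∑[fᵢ²+fⱼ²]≡2*[n*sumSq] f ⟩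
    2 * (n * sumSq f)                              ∎)
    where
    open ≡-Reasoning
    termwise-≡ : ∀ i j → 2 * (f i * f j) ≡ f i * f i + f j * f j
    termwise-≡ i j rewrite c j i = cong (f i * f i +_) (+-identityʳ (f i * f i))

-- Σ_{i ≠ j} fᵢ fⱼ, enumerating the j ≠ i as punchIn i k for k : Fin n.
offDiagonal : ∀ {n} → Vector ℕ (suc n) → ℕ
offDiagonal {n} f = ∑[ i ≤ n ] ∑[ k < n ] (f i * f (punchIn i k))

sum*sum≡sumSq+offDiagonal : ∀ {n} (f : Vector ℕ (suc n)) → sum f * sum f ≡ sumSq f + offDiagonal f
sum*sum≡sumSq+offDiagonal {n} f = begin
  sum f * sum f
    ≡⟨ sum*sum≡∑∑ f f ⟩
  ∑[ i ≤ n ] ∑[ j ≤ n ] (f i * f j)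
    ≡⟨ sum-cong-≗ (λ i → sum-remove {i = i} (λ j → f i * f j)) ⟩
  ∑[ i ≤ n ] (f i * f i + ∑[ k < n ] (f i * f (punchIn i k)))
    ≡⟨ ∑-distrib-+ (λ i → f i * f i) (λ i → ∑[ k < n ] (f i * f (punchIn i k))) ⟩
  sumSq f + offDiagonal f
    ∎
  where open ≡-Reasoning

∑∑-const : ∀ n x → ∑[ i ≤ n ] ∑[ k < n ] x ≡ suc n * n * x
∑∑-const n x = begin
  ∑[ i ≤ n ] ∑[ k < n ] x  ≡⟨ sum-cong-≗ {suc n} (λ _ → sum-const n x) ⟩
  ∑[ i ≤ n ] (n * x)       ≡⟨ sum-const (suc n) (n * x) ⟩
  suc n * (n * x)          ≡⟨ *-assoc (suc n) n x ⟨
  suc n * n * x            ∎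
  where open ≡-Reasoning

module _ {n δ} (f : Vector ℕ (suc n)) (δ≤f : ∀ i → δ ≤ f i) where

  private
    δ²≤product : ∀ i k → δ * δ ≤ f i * f (punchIn i k)
    δ²≤product i k = *-mono-≤ (δ≤f i) (δ≤f (punchIn i k))

    offDiagonal-≥ : ∑[ i ≤ n ] ∑[ k < n ] (δ * δ) ≤ offDiagonal f
    offDiagonal-≥ = sum-mono-≤ (λ i → sum-mono-≤ (δ²≤product i))

  sumSq+[1+n]*n*δ²≤sum*sum : sumSq f + suc n * n * (δ * δ) ≤ sum f * sum f
  sumSq+[1+n]*n*δ²≤sum*sum = begin
    sumSq f + suc n * n * (δ * δ)            ≡⟨ cong (sumSq f +_) (∑∑-const n (δ * δ)) ⟨
    sumSq f + ∑[ i ≤ n ] ∑[ k < n ] (δ * δ)  ≤⟨ +-monoʳ-≤ (sumSq f) offDiagonal-≥ ⟩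
    sumSq f + offDiagonal f                  ≡⟨ sum*sum≡sumSq+offDiagonal f ⟨
    sum f * sum f                            ∎
    where open ≤-Reasoning

  sumSq+[1+n]*n*δ²≡sum*sum⇔products≡δ² :
    (sumSq f + suc n * n * (δ * δ) ≡ sum f * sum f) ⇔ (∀ i k → f i * f (punchIn i k) ≡ δ * δ)
  sumSq+[1+n]*n*δ²≡sum*sum⇔products≡δ² = mk⇔ equality⇒products products⇒equality
    where
    equality⇒offDiagonal : sumSq f + suc n * n * (δ * δ) ≡ sum f * sum f →
                           ∑[ i ≤ n ] ∑[ k < n ] (δ * δ) ≡ offDiagonal f
    equality⇒offDiagonal eq = +-cancelˡ-≡ (sumSq f) _ _
      (trans (cong (sumSq f +_) (∑∑-const n (δ * δ))) (trans eq (sum*sum≡sumSq+offDiagonal f)))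

    equality⇒products : sumSq f + suc n * n * (δ * δ) ≡ sum f * sum f → ∀ i k → f i * f (punchIn i k) ≡ δ * δ
    equality⇒products eq i k = sym (sum-mono-≤-≡⇒≗ (δ²≤product i)
      (sum-mono-≤-≡⇒≗ (λ i → sum-mono-≤ (δ²≤product i)) (equality⇒offDiagonal eq) i) k)

    products⇒equality : (∀ i k → f i * f (punchIn i k) ≡ δ * δ) → sumSq f + suc n * n * (δ * δ) ≡ sum f * sum f
    products⇒equality products≡δ² = begin
      sumSq f + suc n * n * (δ * δ)            ≡⟨ cong (sumSq f +_) (∑∑-const n (δ * δ)) ⟨
      sumSq f + ∑[ i ≤ n ] ∑[ k < n ] (δ * δ)  ≡⟨ cong (sumSq f +_) (sum-cong-≗ (λ i → sum-cong-≗ (sym ∘ products≡δ² i))) ⟩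
      sumSq f + offDiagonal f                  ≡⟨ sum*sum≡sumSq+offDiagonal f ⟨
      sum f * sum f                            ∎
      where open ≡-Reasoning

minOf≤ : ∀ {n} (f : Vector ℕ n) i → minOf f ≤ f i
minOf≤ {suc zero}    f fzero    = ≤-refl
minOf≤ {suc (suc n)} f fzero    = m⊓n≤m (f fzero) _
minOf≤ {suc (suc n)} f (fsuc i) = ≤-trans (m⊓n≤n (f fzero) _) (minOf≤ (f ∘ fsuc) i)

minOf-attained : ∀ {n} (f : Vector ℕ (suc n)) → ∃[ k ] f k ≡ minOf f
minOf-attained {zero}  f = fzero , refl
minOf-attained {suc n} f with ≤-total (f fzero) (minOf (f ∘ fsuc))
... | inj₁ f₀≤ = fzero , sym (m≤n⇒m⊓n≡m f₀≤)
... | inj₂ ≤f₀ with minOf-attained (f ∘ fsuc)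
...   | k , fₖ≡min = fsuc k , trans fₖ≡min (sym (m≥n⇒m⊓n≡n ≤f₀))

Constant⇒≡minOf : ∀ {n} (f : Vector ℕ (suc n)) → Constant f → ∀ i → f i ≡ minOf f
Constant⇒≡minOf f c i = let k , fₖ≡min = minOf-attained f in trans (c i k) fₖ≡min

products≡minOf²⇒Constant : ∀ {n} (f : Vector ℕ (suc n)) → .{{NonZero (minOf f)}} →
  (∀ i k → f i * f (punchIn i k) ≡ minOf f * minOf f) → Constant f
products≡minOf²⇒Constant f products≡μ² i j = trans (≡minOf i) (sym (≡minOf j))
  where
  μ = minOf f
  k = proj₁ (minOf-attained f)
  fₖ≡μ = proj₂ (minOf-attained f)
  ≡minOf : ∀ i → f i ≡ μ
  ≡minOf i with i ≟ k
  ... | yes refl = fₖ≡μ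
  ... | no i≢k = *-cancelʳ-≡ (f i) μ μ (begin
    f i * μ                             ≡⟨ cong (f i *_) fₖ≡μ ⟨
    f i * f k                           ≡⟨ cong (λ j → f i * f j) (punchIn-punchOut i≢k) ⟨
    f i * f (punchIn i (punchOut i≢k))  ≡⟨ products≡μ² i (punchOut i≢k) ⟩
    μ * μ                               ∎)
    where open ≡-Reasoning

m≡o∸n⇔m+n≡o : ∀ {m n o} → n ≤ o → (m ≡ o ∸ n) ⇔ (m + n ≡ o)
m≡o∸n⇔m+n≡o {m} {n} n≤o = mk⇔
  (λ m≡o∸n → trans (cong (_+ n) m≡o∸n) (m∸n+n≡m n≤o))
  (λ m+n≡o → trans (sym (m+n∸n≡m m n)) (cong (_∸ n) m+n≡o))

r*m*[r*m]≤m*[r*m]⇒m≡0 : ∀ {r m} → 2 ≤ r → r * m * (r * m) ≤ m * (r * m) → m ≡ 0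
r*m*[r*m]≤m*[r*m]⇒m≡0 {m = zero}                _                   _  = refl
r*m*[r*m]≤m*[r*m]⇒m≡0 {suc (suc r)} {suc m} (s≤s (s≤s z≤n)) le =
  contradiction (*-cancelʳ-≤ (suc (suc r) * suc m) (suc m) _ le) (<⇒≱ (m<m+n (suc m) z<s))

membership : ∀ {n} → Fin n → Subset n → ℕ
membership v e = if does (v ∈? e) then 1 else 0

sum-membership : ∀ {n} (e : Subset n) → sum (λ v → membership v e) ≡ ∣ e ∣
sum-membership []            = refl
sum-membership (inside ∷ e)  = cong suc (sum-membership e)
sum-membership (outside ∷ e) = sum-membership e

degreeIn : ∀ {n} → List (Subset n) → Fin n → ℕ
degreeIn es v = length (filter (v ∈?_) es)

degreeIn-∷ : ∀ {n} (e : Subset n) es v → degreeIn (e ∷ es) v ≡ membership v e + degreeIn es v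
degreeIn-∷ e es v with v ∈? e
... | yes _ = refl
... | no  _ = refl

sum-degreeIn : ∀ {n r} (es : List (Subset n)) → All (λ e → ∣ e ∣ ≡ r) es → sum (degreeIn es) ≡ r * length es
sum-degreeIn {n} {r} []       []               = trans (sum-const n 0) (trans (*-zeroʳ n) (sym (*-zeroʳ r)))
sum-degreeIn {r = r}  (e ∷ es) (∣e∣≡r ∷ ∣es∣≡r) = begin
  sum (degreeIn (e ∷ es))                         ≡⟨ sum-cong-≗ (degreeIn-∷ e es) ⟩
  sum (λ v → membership v e + degreeIn es v)      ≡⟨ ∑-distrib-+ (λ v → membership v e) (degreeIn es) ⟩
  sum (λ v → membership v e) + sum (degreeIn es)  ≡⟨ cong₂ _+_ (trans (sum-membership e) ∣e∣≡r) (sum-degreeIn es ∣es∣≡r) ⟩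
  r + r * length es                               ≡⟨ *-suc r (length es) ⟨
  r * suc (length es)                             ∎
  where open ≡-Reasoning

module _ {n r} (H : Hypergraph n r) where

  sum-degree : sum (degree H) ≡ r * numEdges H
  sum-degree = sum-degreeIn (edges H) (uniform H)

  degree≤numEdges : ∀ v → degree H v ≤ numEdges H
  degree≤numEdges v = length-filter (v ∈?_) (edges H)

  sumSq-degree≤numEdges*sum-degree : sumSq (degree H) ≤ numEdges H * sum (degree H)
  sumSq-degree≤numEdges*sum-degree = begin
    sumSq (degree H)                        ≤⟨ sum-mono-≤ (λ v → *-monoˡ-≤ (degree H v) (degree≤numEdges v)) ⟩
    ∑[ v < n ] (numEdges H * degree H v)    ≡⟨ *-distribˡ-sum (numEdges H) (degree H) ⟨
    numEdges H * sum (degree H)             ∎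
    where open ≤-Reasoning

  numEdges≡0⇒Regular : numEdges H ≡ 0 → Regular H
  numEdges≡0⇒Regular m≡0 u v = trans (degree≡0 u) (sym (degree≡0 v))
    where
    degree≡0 : ∀ v → degree H v ≡ 0
    degree≡0 v = n≤0⇒n≡0 (subst (degree H v ≤_) m≡0 (degree≤numEdges v))

  sumSq≡sum*sum⇒numEdges≡0 : 2 ≤ r → sumSq (degree H) ≡ sum (degree H) * sum (degree H) → numEdges H ≡ 0
  sumSq≡sum*sum⇒numEdges≡0 r≥2 M≡S = r*m*[r*m]≤m*[r*m]⇒m≡0 r≥2 (begin
    r * numEdges H * (r * numEdges H)    ≡⟨ cong (λ D → D * D) sum-degree ⟨
    sum (degree H) * sum (degree H)      ≡⟨ M≡S ⟨
    sumSq (degree H)                     ≤⟨ sumSq-degree≤numEdges*sum-degree ⟩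
    numEdges H * sum (degree H)          ≡⟨ cong (numEdges H *_) sum-degree ⟩
    numEdges H * (r * numEdges H)        ∎)
    where open ≤-Reasoning

Σᵥ≡sum : ∀ {n} (f : Vector ℕ n) → Σᵥ f ≡ sum f
Σᵥ≡sum {zero}  f = refl
Σᵥ≡sum {suc n} f = cong (f fzero +_) (Σᵥ≡sum (f ∘ fsuc))

zagreb₁≡sumSq : ∀ {n r} (H : Hypergraph n r) → zagreb₁ H ≡ sumSq (degree H)
zagreb₁≡sumSq H = Σᵥ≡sum (λ v → degree H v * degree H v)

module _ {n r} (H : Hypergraph (suc n) r) (r≥2 : 2 ≤ r) where

  private
    d = degree H
    δ = minDegree H

  sumSq+[1+n]*n*δ²≡sum*sum⇔Regular : (sumSq d + suc n * n * (δ * δ) ≡ sum d * sum d) ⇔ Regular H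
  sumSq+[1+n]*n*δ²≡sum*sum⇔Regular = mk⇔ equality⇒regular regular⇒equality
    where
    open Equivalence (sumSq+[1+n]*n*δ²≡sum*sum⇔products≡δ² d (minOf≤ d))

    equality⇒regular : sumSq d + suc n * n * (δ * δ) ≡ sum d * sum d → Regular H
    equality⇒regular eq with δ ℕ.≟ 0
    ... | no δ≢0  = products≡minOf²⇒Constant d {{≢-nonZero δ≢0}} (to eq)
    ... | yes δ≡0 = numEdges≡0⇒Regular H (sumSq≡sum*sum⇒numEdges≡0 H r≥2 (begin
      sumSq d                          ≡⟨ +-identityʳ (sumSq d) ⟨
      sumSq d + 0                      ≡⟨ cong (sumSq d +_) T≡0 ⟨
      sumSq d + suc n * n * (δ * δ)    ≡⟨ eq ⟩
      sum d * sum d                    ∎))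
      where
      open ≡-Reasoning
      T≡0 : suc n * n * (δ * δ) ≡ 0
      T≡0 = trans (cong (λ μ → suc n * n * (μ * μ)) δ≡0) (*-zeroʳ (suc n * n))

    regular⇒equality : Regular H → sumSq d + suc n * n * (δ * δ) ≡ sum d * sum d
    regular⇒equality reg = from (λ i k → cong₂ _*_ (≡δ i) (≡δ (punchIn i k)))
      where
      ≡δ : ∀ i → d i ≡ δ
      ≡δ = Constant⇒≡minOf d reg

lemma2p1 : ∀ {n r : ℕ} (H : Hypergraph n r) → 2 ≤ r → 3 ≤ n →
    ((r * numEdges H) * (r * numEdges H) ≤ n * zagreb₁ H)
    × (zagreb₁ H ≤ (r * numEdges H) * (r * numEdges H) ∸ n * (n ∸ 1) * (minDegree H * minDegree H))
    × (zagreb₁ H + n * (n ∸ 1) * (minDegree H * minDegree H) ≤ (r * numEdges H) * (r * numEdges H))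
    × (((r * numEdges H) * (r * numEdges H) ≡ n * zagreb₁ H) ⇔ Regular H)
    × ((zagreb₁ H ≡ (r * numEdges H) * (r * numEdges H) ∸ n * (n ∸ 1) * (minDegree H * minDegree H)) ⇔ Regular H)
lemma2p1 {suc n} H r≥2 _ rewrite zagreb₁≡sumSq H | sym (sum-degree H) =
    sum*sum≤n*sumSq d
  , m+n≤o⇒m≤o∸n (sumSq d) lower
  , lower
  , sum*sum≡n*sumSq⇔Constant d
  , sumSq+[1+n]*n*δ²≡sum*sum⇔Regular H r≥2 ⇔-∘ m≡o∸n⇔m+n≡o (m+n≤o⇒n≤o (sumSq d) lower)
  where
  d = degree H
  lower : sumSq d + suc n * n * (minDegree H * minDegree H) ≤ sum d * sum d
  lower = sumSq+[1+n]*n*δ²≤sum*sum d (minOf≤ d)
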